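{- Let $(X,A_\tau,\rightarrow)$ be a labelled transition system and let $R\subseteq X\times X$ be a branching bisimulation. Then for all states $q,q',p$: if $q\rightarrow_\tau q'$, $R(q,p)$ and $q'\mathrel{\#_b}p$, then there exist $p',p''$ with $p\twoheadrightarrow_\tau p'\rightarrow_\tau p''$, $R(q,p')$ and $R(q',p'')$. Symmetrically, for all states $q,p,p'$: if $p\rightarrow_\tau p'$, $R(q,p)$ and $q\mathrel{\#_b}p'$, then there exist $q',q''$ with $q\twoheadrightarrow_\tau q'\rightarrow_\tau q''$, $R(q',p)$ and $R(q'',p')$.
   Context: An LTS is a triple $(X,A_\tau,\rightarrow)$ with $X$ a set of states, $A_\tau=A\cup\{\tau\}$ where $\tau\notin A$ is the silent action, and $\rightarrow\subseteq X\times A_\tau\times X$; write $q\rightarrow_u q'$ for $(q,u,q')\in\rightarrow$. The letter $a$ ranges over $A$. $\twoheadrightarrow_\tau$ is the reflexive-transitive closure of $\rightarrow_\tau$. $R$ is a branching bisimulation if: if $q\rightarrow_\tau q'$ and $R(q,p)$ then $R(q',p)$ or $\exists p',p''(p\twoheadrightarrow_\tau p'\rightarrow_\tau p''\wedge R(q,p')\wedge R(q',p''))$; if $q\rightarrow_a q'$ and $R(q,p)$ then $\exists p',p''(p\twoheadrightarrow_\tau p'\rightarrow_a p''\wedge R(q,p')\wedge R(q',p''))$; and symmetrically: if $p\rightarrow_\tau p'$ and $R(q,p)$ then $R(q,p')$ or $\exists q',q''(q\twoheadrightarrow_\tau q'\rightarrow_\tau q''\wedge R(q',p)\wedge R(q'',p'))$;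 if $p\rightarrow_a p'$ and $R(q,p)$ then $\exists q',q''(q\twoheadrightarrow_\tau q'\rightarrow_a q''\wedge R(q',p)\wedge R(q'',p'))$. A relation $Q\subseteq X\times X$ is a branching apartness if: (symm) $Q(p,q)\Rightarrow Q(q,p)$; (in$_{b\tau}$) if $q\rightarrow_\tau q'$, $Q(q',p)$, and for all $p',p''$ with $p\twoheadrightarrow_\tau p'\rightarrow_\tau p''$ we have $Q(q,p')\vee Q(q',p'')$, then $Q(q,p)$; (in$_b$) for each $a\in A$: if $q\rightarrow_a q'$ and for all $p',p''$ with $p\twoheadrightarrow_\tau p'\rightarrow_a p''$ we have $Q(q,p')\vee Q(q',p'')$, then $Q(q,p)$. $q\mathrel{\#_b}p$ means $Q(q,p)$ for every branching apartness $Q$. -}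

module Defs where

open import Data.Product using (Σ; ∃; _×_; _,_)
open import Data.Sum using (_⊎_)
open import Relation.Binary.Construct.Closure.ReflexiveTransitive using (Star)

data Act (A : Set) : Set where
  τ   : Act A
  act : A → Act A

record LTS : Set₁ where
  field
    X    : Set
    A    : Set
    Step : X → Act A → X → Set

module _ (L : LTS) where
  open LTS L

  _→τ_ : X → X → Set
  q →τ q' = Step q τ q'

  _↠τ_ : X → X → Set
  _↠τ_ = Star _→τ_

  Rel : Set₁
  Rel = X → X → Set

  record IsBranchingBisim (R : Rel) : Set where
    field
      left-τ  : ∀ {q q' p} → q →τ q' → R q p →
                R q' p ⊎ Σ X (λ p' → Σ X (λ p'' →
                  (p ↠τ p') × (p' →τ p'') × R q p' × R q' p''))
      left-a  : ∀ {a q q' p} → Step q (act a) q' → R q p →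
                Σ X (λ p' → Σ X (λ p'' →
                  (p ↠τ p') × Step p' (act a) p'' × R q p' × R q' p''))
      right-τ : ∀ {q p p'} → p →τ p' → R q p →
                R q p' ⊎ Σ X (λ q' → Σ X (λ q'' →
                  (q ↠τ q') × (q' →τ q'') × R q' p × R q'' p'))
      right-a : ∀ {a q p p'} → Step p (act a) p' → R q p →
                Σ X (λ q' → Σ X (λ q'' →
                  (q ↠τ q') × Step q' (act a) q'' × R q' p × R q'' p'))

  record IsBranchingApartness (Q : Rel) : Set where
    field
      symm : ∀ {p q} → Q p q → Q q p
      in-bτ : ∀ {q q' p} → q →τ q' → Q q' p →
              (∀ p' p'' → p ↠τ p' → p' →τ p'' → Q q p' ⊎ Q q' p'') →
              Q q p
      in-b : ∀ {a q q' p} → Step q (act a) q' →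
             (∀ p' p'' → p ↠τ p' → Step p' (act a) p'' → Q q p' ⊎ Q q' p'') →
             Q q p

  _#b_ : X → X → Set₁
  q #b p = (Q : Rel) → IsBranchingApartness Q → Q q p

-- The relation "related by R in neither direction" is itself a branching
-- apartness: each apartness rule, read contrapositively, is exactly a
-- transfer condition of the bisimulation R. Hence q #b p forces ¬ R q p
-- (and ¬ R p q), which rules out the first alternative of the τ-transfer
-- conditions, leaving the required τ-step.
module Submission where

open import Defs
open import Data.Product using (Σ; _×_; _,_; proj₁; proj₂)
open import Data.Sum using (_⊎_; inj₁; inj₂)
open import Data.Empty using (⊥-elim)
open import Function using (_∘_)
open import Relation.Nullary using (¬_)

module _ (L : LTS) {R : LTS.X L → LTS.X L → Set} (B : IsBranchingBisim L R) where
  open LTS L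
  open IsBranchingBisim B

  Unrelated : X → X → Set
  Unrelated x y = ¬ R x y × ¬ R y x

  private
    transfer-not-unrelated : ∀ {q q' p' p''} →
                             Unrelated q p' ⊎ Unrelated q' p'' →
                             ¬ (R q p' × R q' p'') × ¬ (R p' q × R p'' q')
    transfer-not-unrelated (inj₁ (n , n⁻¹)) = n ∘ proj₁ , n⁻¹ ∘ proj₁
    transfer-not-unrelated (inj₂ (n , n⁻¹)) = n ∘ proj₂ , n⁻¹ ∘ proj₂

  unrelated-isBranchingApartness : IsBranchingApartness L Unrelated
  unrelated-isBranchingApartness = record
    { symm  = λ (n , n⁻¹) → n⁻¹ , n
    ; in-bτ = in-bτ
    ; in-b  = in-b
    }
    where
    in-bτ : ∀ {q q' p} → _→τ_ L q q' → Unrelated q' p →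
            (∀ p' p'' → _↠τ_ L p p' → _→τ_ L p' p'' → Unrelated q p' ⊎ Unrelated q' p'') →
            Unrelated q p
    in-bτ {q} {p = p} q→q' (n , n⁻¹) h = unrelated , unrelated⁻¹
      where
      unrelated : ¬ R q p
      unrelated r with left-τ q→q' r
      ... | inj₁ r' = n r'
      ... | inj₂ (p' , p'' , p↠p' , p'→p'' , rs) = proj₁ (transfer-not-unrelated (h p' p'' p↠p' p'→p'')) rs
      unrelated⁻¹ : ¬ R p q
      unrelated⁻¹ r with right-τ q→q' r
      ... | inj₁ r' = n⁻¹ r'
      ... | inj₂ (p' , p'' , p↠p' , p'→p'' , rs) = proj₂ (transfer-not-unrelated (h p' p'' p↠p' p'→p'')) rs
    in-b : ∀ {a q q' p} → Step q (act a) q' →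
           (∀ p' p'' → _↠τ_ L p p' → Step p' (act a) p'' → Unrelated q p' ⊎ Unrelated q' p'') →
           Unrelated q p
    in-b {q = q} {p = p} q→q' h = unrelated , unrelated⁻¹
      where
      unrelated : ¬ R q p
      unrelated r with left-a q→q' r
      ... | (p' , p'' , p↠p' , p'→p'' , rs) = proj₁ (transfer-not-unrelated (h p' p'' p↠p' p'→p'')) rs
      unrelated⁻¹ : ¬ R p q
      unrelated⁻¹ r with right-a q→q' r
      ... | (p' , p'' , p↠p' , p'→p'' , rs) = proj₂ (transfer-not-unrelated (h p' p'' p↠p' p'→p'')) rs

  #b⇒¬R : ∀ {q p} → _#b_ L q p → ¬ R q p
  #b⇒¬R q#p = proj₁ (q#p Unrelated unrelated-isBranchingApartness)

  resolve-by-apartness : ∀ {q p} {Matched : Set} → _#b_ L q p →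
                         R q p ⊎ Matched → Matched
  resolve-by-apartness q#p (inj₁ r) = ⊥-elim (#b⇒¬R q#p r)
  resolve-by-apartness q#p (inj₂ w) = w

lemma3p29 : (L : LTS) → (R : LTS.X L → LTS.X L → Set) → IsBranchingBisim L R →
    ((q q' p : LTS.X L) → _→τ_ L q q' → R q p → _#b_ L q' p →
      Σ (LTS.X L) (λ p' → Σ (LTS.X L) (λ p'' →
        _↠τ_ L p p' × _→τ_ L p' p'' × R q p' × R q' p'')))
    × ((q p p' : LTS.X L) → _→τ_ L p p' → R q p → _#b_ L q p' →
      Σ (LTS.X L) (λ q' → Σ (LTS.X L) (λ q'' →
        _↠τ_ L q q' × _→τ_ L q' q'' × R q' p × R q'' p')))
lemma3p29 L R B =
    (λ q q' p q→q' qRp q'#p → resolve-by-apartness L B q'#p (left-τ q→q' qRp))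
  , (λ q p p' p→p' qRp q#p' → resolve-by-apartness L B q#p' (right-τ p→p' qRp))
  where open IsBranchingBisim B
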